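{- Let $\mathcal{F}$ be a hereditary family of hypergraphs, let $k\ge 2$ and $d$ be integers, and let $\mathcal{H}\in\mathcal{F}$. If the VC-dimension of $\mathcal{H}$ is at least $kd-1$, then $m_k(\mathcal{F})>(k-1)d$.
   Context: A hypergraph $\mathcal{H}=(V,E)$ consists of a finite vertex set $V$ and a collection $E$ of subsets of $V$ (edges); it is $m$-heavy if all edges have size at least $m$. For $X\subset V$, the trace of $\mathcal{H}$ on $X$ is $(X,\{e\cap X:e\in E\})$. A family of hypergraphs is hereditary if it is closed under taking subhypergraphs (hypergraphs $(V',E')$ with $V'\subset V$, $E'\subset E$) and traces. The VC-dimension of $\mathcal{H}$ is the largest size of a set $X\subset V$ that is shattered, i.e., such that $\{e\cap X: e\in E\}$ contains every subset of $X$. A $k$-coloring of the vertices is polychromatic if every edge contains a vertex of each of the $k$ colors. $m_k(\mathcal{F})$ is the least $m$ such that every $m$-heavy hypergraph in $\mathcal{F}$ has a polychromatic $k$-coloring, and $m_k(\mathcal{F})=\infty$ if no such $m$ exists. -}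

module Defs where

open import Data.Nat using (ℕ; _≤_; _<_)
open import Data.Fin using (Fin)
open import Data.Fin.Subset using (Subset; _⊆_; _∩_; _∈_; ∣_∣)
open import Data.Product using (Σ; _×_; ∃)
open import Relation.Binary.PropositionalEquality using (_≡_)

-- A hypergraph: vertices are labelled by an ambient Fin n; the vertex set is
-- V ⊆ Fin n, and the edge collection E is a predicate on subsets of Fin n
-- (a set of subsets), every edge being contained in V.
record Hypergraph : Set₁ where
  field
    n    : ℕ
    V    : Subset n
    E    : Subset n → Set
    E⊆V  : ∀ e → E e → e ⊆ V
open Hypergraph public

Family : Set₁
Family = Hypergraph → Set

subhypergraph : (H : Hypergraph) (V' : Subset (n H)) (E' : Subset (n H) → Set) →
                (∀ e → E' e → e ⊆ V') → Hypergraph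
subhypergraph H V' E' p = record { n = n H ; V = V' ; E = E' ; E⊆V = p }

trace : (H : Hypergraph) (X : Subset (n H)) → Hypergraph
trace H X = record
  { n = n H
  ; V = X
  ; E = λ f → Σ (Subset (n H)) λ e → E H e × (f ≡ e ∩ X)
  ; E⊆V = λ f → λ { (e , _ , f≡) → helper f e f≡ }
  }
  where
  open import Data.Product using (_,_)
  open import Relation.Binary.PropositionalEquality using (subst; sym)
  open import Data.Fin.Subset.Properties using (x∈p∩q⁺; x∈p∩q⁻)
  helper : ∀ f e → f ≡ e ∩ X → f ⊆ X
  helper f e f≡ {x} x∈f with x∈p∩q⁻ e X (subst (x ∈_) f≡ x∈f)
  ... | (_ , x∈X) = x∈X

Hereditary : Family → Set₁
Hereditary F =
  (∀ H → F H → (V' : Subset (n H)) (E' : Subset (n H) → Set)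
     (p : ∀ e → E' e → e ⊆ V') →
     V' ⊆ V H → (∀ e → E' e → E H e) → F (subhypergraph H V' E' p))
  × (∀ H → F H → (X : Subset (n H)) → X ⊆ V H → F (trace H X))

Heavy : ℕ → Hypergraph → Set
Heavy m H = ∀ e → E H e → m ≤ ∣ e ∣

Polychromatic : (k : ℕ) (H : Hypergraph) → (Fin (n H) → Fin k) → Set
Polychromatic k H c = ∀ e → E H e → (i : Fin k) → ∃ λ v → v ∈ e × c v ≡ i

Shattered : (H : Hypergraph) → Subset (n H) → Set
Shattered H X = X ⊆ V H × (∀ Y → Y ⊆ X → ∃ λ e → E H e × (e ∩ X ≡ Y))

VCdim≥ : Hypergraph → ℕ → Set
VCdim≥ H t = ∃ λ X → Shattered H X × t ≤ ∣ X ∣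

PolyProperty : Family → ℕ → ℕ → Set₁
PolyProperty F k m = ∀ H → F H → Heavy m H → ∃ λ c → Polychromatic k H c

-- m_k(F) > t, where m_k(F) = least m with PolyProperty (∞ if none):
-- equivalently every m with the property exceeds t.
mk-exceeds : Family → ℕ → ℕ → Set₁
mk-exceeds F k t = ∀ m → PolyProperty F k m → t < m

{-# OPTIONS --safe #-}
-- Suppose m ≤ (k-1)d and let X be shattered with |X| ≥ kd-1.  The trace of H
-- on X, cut down to its edges of size ≥ m, is an m-heavy member of F; if it had
-- a polychromatic k-colouring, some colour class of X would have at most |X|/k
-- elements, so X minus that class has at least (k-1)d ≥ m elements.  Since X
-- is shattered, this set is itself an edge of the trace, and it misses a colour.
module Submission where

open import Defs
open import Data.Nat using (ℕ; zero; suc; _≤_; _*_; _∸_; _+_; s≤s; _≤?_)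
open import Data.Nat.Properties
  using ( +-0-commutativeMonoid; module ≤-Reasoning; ≤-refl; ≤-reflexive; ≤-trans; <⇒≤
        ; <-irrefl; ≰⇒>; ≮⇒≥; +-suc; +-comm; +-mono-≤; +-monoʳ-≤; +-cancelʳ-≤; *-monoʳ-≤
        ; m≤n+m∸n )
open import Data.Fin using (Fin) renaming (zero to fzero; suc to fsuc)
open import Data.Fin.Properties using (_≟_)
open import Data.Fin.Subset using (Subset; _∩_; _─_; _∈_; _∉_; ∣_∣; inside; outside)
open import Data.Fin.Subset.Properties using (p─q⊆p)
open import Data.Vec using (_∷_; []; tabulate; here; there)
open import Data.Vec.Properties using (lookup∘tabulate; lookup⇒[]=)
open import Data.Product using (_×_; _,_; proj₁; proj₂; ∃)
open import Algebra.Properties.CommutativeMonoid.Sum +-0-commutativeMonoid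
  using (sum; sum-syntax; sum-replicate-zero)
open import Function using (_∘_)
open import Data.Nat.Solver using (module +-*-Solver)
open +-*-Solver using (solve; _:=_; _:+_; _:*_; con)
open import Relation.Nullary using (¬_; does; yes; no)
open import Relation.Nullary.Decidable using (dec-true)
open import Relation.Binary.PropositionalEquality using (_≡_; refl; sym; trans; cong)

private
  variable
    N k : ℕ

fibre : (Fin N → Fin k) → Fin k → Subset N
fibre c i = tabulate λ v → does (c v ≟ i)

∈-fibre : (c : Fin N → Fin k) {v : Fin N} {i : Fin k} → c v ≡ i → v ∈ fibre c i
∈-fibre c {v} {i} cv≡i =
  lookup⇒[]= v _ (trans (lookup∘tabulate _ v) (dec-true (c v ≟ i) cv≡i))

x∈p─q⇒x∉q : {p q : Subset N} {x : Fin N} → x ∈ p ─ q → x ∉ q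
x∈p─q⇒x∉q {p = inside ∷ p} {outside ∷ q} here        ()
x∈p─q⇒x∉q {p = _ ∷ p}      {_ ∷ q}       (there x∈) (there x∈q) = x∈p─q⇒x∉q x∈ x∈q

∣p─q∣+∣p∩q∣≡∣p∣ : (p q : Subset N) → ∣ p ─ q ∣ + ∣ p ∩ q ∣ ≡ ∣ p ∣
∣p─q∣+∣p∩q∣≡∣p∣ []            []            = refl
∣p─q∣+∣p∩q∣≡∣p∣ (outside ∷ p) (outside ∷ q) = ∣p─q∣+∣p∩q∣≡∣p∣ p q
∣p─q∣+∣p∩q∣≡∣p∣ (outside ∷ p) (inside ∷ q)  = ∣p─q∣+∣p∩q∣≡∣p∣ p q
∣p─q∣+∣p∩q∣≡∣p∣ (inside ∷ p)  (outside ∷ q) = cong suc (∣p─q∣+∣p∩q∣≡∣p∣ p q)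
∣p─q∣+∣p∩q∣≡∣p∣ (inside ∷ p)  (inside ∷ q)  =
  trans (+-suc ∣ p ─ q ∣ ∣ p ∩ q ∣) (cong suc (∣p─q∣+∣p∩q∣≡∣p∣ p q))

∑∣[j≟i]∷pᵢ∣≡1+∑∣pᵢ∣ : (j : Fin k) (p : Fin k → Subset N) →
  ∑[ i < k ] ∣ does (j ≟ i) ∷ p i ∣ ≡ suc (∑[ i < k ] ∣ p i ∣)
∑∣[j≟i]∷pᵢ∣≡1+∑∣pᵢ∣ fzero    p = refl
∑∣[j≟i]∷pᵢ∣≡1+∑∣pᵢ∣ (fsuc j) p =
  trans (cong (∣ p fzero ∣ +_) (∑∣[j≟i]∷pᵢ∣≡1+∑∣pᵢ∣ j (p ∘ fsuc))) (+-suc _ _)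

∑∣p∩fibre∣≡∣p∣ : (c : Fin N → Fin k) (p : Subset N) → ∑[ i < k ] ∣ p ∩ fibre c i ∣ ≡ ∣ p ∣
∑∣p∩fibre∣≡∣p∣ {k = k} c [] = sum-replicate-zero k
∑∣p∩fibre∣≡∣p∣ c (outside ∷ p) = ∑∣p∩fibre∣≡∣p∣ (c ∘ fsuc) p
∑∣p∩fibre∣≡∣p∣ c (inside ∷ p)  =
  trans (∑∣[j≟i]∷pᵢ∣≡1+∑∣pᵢ∣ (c fzero) λ i → p ∩ fibre (c ∘ fsuc) i)
        (cong suc (∑∣p∩fibre∣≡∣p∣ (c ∘ fsuc) p))

∃-term-≤-average : (a : Fin (suc k) → ℕ) → ∃ λ i → suc k * a i ≤ sum a
∃-term-≤-average {zero}  a = fzero , ≤-refl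
∃-term-≤-average {suc k} a with ∃-term-≤-average (a ∘ fsuc)
... | j , k*aⱼ≤∑ with a fzero ≤? a (fsuc j)
...   | yes a₀≤aⱼ = fzero , +-monoʳ-≤ (a fzero) (≤-trans (*-monoʳ-≤ (suc k) a₀≤aⱼ) k*aⱼ≤∑)
...   | no  a₀≰aⱼ = fsuc j , +-mono-≤ (<⇒≤ (≰⇒> a₀≰aⱼ)) k*aⱼ≤∑

complement-of-small-part : ∀ k d a M → suc k * d ∸ 1 ≤ M → suc k * a ≤ M → k * d + a ≤ M
complement-of-small-part k d a M kd∸1≤M ka≤M = ≮⇒≥ λ M<kd+a →
  <-irrefl refl (+-cancelʳ-≤ (k * suc M) (suc M) M (begin
    suc M + k * suc M            ≡⟨⟩
    suc k * suc M                ≤⟨ *-monoʳ-≤ (suc k) M<kd+a ⟩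
    suc k * (k * d + a)          ≡⟨ regroup ⟩
    k * (suc k * d) + suc k * a  ≤⟨ +-mono-≤ (*-monoʳ-≤ k kd≤1+M) ka≤M ⟩
    k * suc M + M                ≡⟨ +-comm (k * suc M) M ⟩
    M + k * suc M                ∎))
  where
  open ≤-Reasoning
  kd≤1+M : suc k * d ≤ suc M
  kd≤1+M = ≤-trans (m≤n+m∸n (suc k * d) 1) (s≤s kd∸1≤M)
  regroup : suc k * (k * d + a) ≡ k * (suc k * d) + suc k * a
  regroup = solve 3 (λ k d a → (con 1 :+ k) :* (k :* d :+ a)
                             := k :* ((con 1 :+ k) :* d) :+ (con 1 :+ k) :* a) refl k d a

∃-colour-with-large-complement : ∀ {k} d (c : Fin N → Fin (suc k)) (X : Subset N) →
  suc k * d ∸ 1 ≤ ∣ X ∣ → ∃ λ i → k * d ≤ ∣ X ─ fibre c i ∣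
∃-colour-with-large-complement {k = k} d c X kd∸1≤∣X∣
  with ∃-term-≤-average (λ i → ∣ X ∩ fibre c i ∣)
... | i , k*∣Xᵢ∣≤∑ = i , +-cancelʳ-≤ _ _ _ (begin
    k * d + ∣ X ∩ fibre c i ∣              ≤⟨ complement-of-small-part k d _ _ kd∸1≤∣X∣ k*∣Xᵢ∣≤∣X∣ ⟩
    ∣ X ∣                                  ≡⟨ ∣p─q∣+∣p∩q∣≡∣p∣ X (fibre c i) ⟨
    ∣ X ─ fibre c i ∣ + ∣ X ∩ fibre c i ∣  ∎)
  where
  open ≤-Reasoning
  k*∣Xᵢ∣≤∣X∣ : suc k * ∣ X ∩ fibre c i ∣ ≤ ∣ X ∣
  k*∣Xᵢ∣≤∣X∣ = ≤-trans k*∣Xᵢ∣≤∑ (≤-reflexive (∑∣p∩fibre∣≡∣p∣ c X))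

heavyPart : ℕ → Hypergraph → Hypergraph
heavyPart m G = subhypergraph G (V G) (λ e → E G e × m ≤ ∣ e ∣) (λ e → E⊆V G e ∘ proj₁)

heavyPart-heavy : ∀ m G → Heavy m (heavyPart m G)
heavyPart-heavy m G e (_ , m≤∣e∣) = m≤∣e∣

heavyPart-closed : ∀ {F} → Hereditary F → ∀ m G → F G → F (heavyPart m G)
heavyPart-closed (closed-sub , _) m G FG = closed-sub G FG (V G) _ _ (λ v∈V → v∈V) (λ e → proj₁)

shattered⇒¬polychromatic : ∀ {k} d m H X → Shattered H X → suc k * d ∸ 1 ≤ ∣ X ∣ →
  m ≤ k * d → (c : Fin (n H) → Fin (suc k)) →
  ¬ Polychromatic (suc k) (heavyPart m (trace H X)) c
shattered⇒¬polychromatic d m H X (_ , shatters) kd∸1≤∣X∣ m≤kd c poly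
  with ∃-colour-with-large-complement d c X kd∸1≤∣X∣
... | i , kd≤∣Y∣ with shatters (X ─ fibre c i) (p─q⊆p X (fibre c i))
... | e , Ee , e∩X≡Y with poly (X ─ fibre c i) ((e , Ee , sym e∩X≡Y) , ≤-trans m≤kd kd≤∣Y∣) i
... | v , v∈Y , cv≡i = x∈p─q⇒x∉q v∈Y (∈-fibre c cv≡i)

lemma5 : (F : Family) → Hereditary F → (k d : ℕ) → 2 ≤ k →
    (H : Hypergraph) → F H → VCdim≥ H (k * d ∸ 1) →
    mk-exceeds F k ((k ∸ 1) * d)
lemma5 F hereditary (suc k) d _ H FH (X , shattered , kd∸1≤∣X∣) m has-colourings =
  ≰⇒> λ m≤kd →
    let FHX      = proj₂ hereditary H FH X (proj₁ shattered)
        c , poly = has-colourings (heavyPart m (trace H X))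
                     (heavyPart-closed hereditary m (trace H X) FHX)
                     (heavyPart-heavy m (trace H X))
    in shattered⇒¬polychromatic d m H X shattered kd∸1≤∣X∣ m≤kd c poly
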